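{- Let $n\geq 1$, $M_n=\{1,2,\dots,n\}$, and let $\mathcal{F}\subset 2^{M_n}$ be a union-closed family (i.e. $A\cup B\in\mathcal{F}$ for all $A,B\in\mathcal{F}$) with $\bigcup_{A\in\mathcal{F}}A=M_n$. Then for every $A\in\mathcal{F}$ with $|A|\geq 2$ there exists $y\in A$ such that $$|\{F\in\mathcal{F}: y\in F\}|\geq \frac{1}{2^{|A|-2}+1}|\mathcal{F}|.$$
   Context: $|X|$ denotes the cardinality of a set $X$. -}

module Defs where

open import Data.Nat using (ℕ)
open import Data.List using (List; length; filter)
open import Data.List.Membership.Propositional using (_∈_)
open import Data.Fin using (Fin)
open import Data.Fin.Subset using (Subset; _∪_)
open import Data.Fin.Subset.Properties using (_∈?_)

-- A finite family of subsets of M_n = Fin n is represented by a duplicate-free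
-- list of subsets.

UnionClosed : {n : ℕ} → List (Subset n) → Set
UnionClosed 𝓕 = ∀ {A B} → A ∈ 𝓕 → B ∈ 𝓕 → (A ∪ B) ∈ 𝓕

count : {n : ℕ} → Fin n → List (Subset n) → ℕ
count y 𝓕 = length (filter (y ∈?_) 𝓕)

module Submission where

-- Write hits F = |F ∩ A|. As A ∈ 𝓕 and 𝓕 is union-closed, F ↦ F ∪ A maps the members
-- disjoint from A into the members with hits = |A| ≥ 2, injectively since G ↦ G ─ A
-- undoes it. So members with hits = 0 are outnumbered by members with hits ≥ 2, whence
-- Σ_F hits F ≥ |𝓕|. Double counting rewrites Σ_F hits F as Σ_{y ∈ A} |{F ∈ 𝓕 : y ∈ F}|,
-- so some y ∈ A lies in at least |𝓕| / |A| members; finally |A| ≤ 2^(|A| - 2) + 1.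

open import Defs
open import Data.Nat using (ℕ; _+_; _*_; _∸_; _^_; _≤_)
open import Data.Product using (Σ; _×_)
open import Data.List using (List; length)
open import Data.List.Membership.Propositional using (_∈_)
open import Data.List.Relation.Unary.Unique.Propositional using (Unique)
open import Data.Fin using (Fin)
open import Data.Fin.Subset using (Subset; ⋃; ⊤; ∣_∣)
open import Relation.Binary.PropositionalEquality using (_≡_)
import Data.Fin.Subset as S

open import Level using (Level)
open import Data.Bool.Properties using (∨-identityʳ)
open import Data.Nat using (zero; suc; z≤n; s≤s; _<_)
open import Data.Nat.Properties
open import Data.Nat.ListAction using (sum)
open import Algebra.Properties.CommutativeSemigroup +-commutativeSemigroup using (x∙yz≈y∙xz)
open import Data.Product using (_,_; proj₂; ∃-syntax)
open import Data.Sum using (inj₁; inj₂; [_,_]′)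
open import Data.List using ([]; _∷_; _++_; map; filter; tabulate; allFin)
open import Data.List.Properties using (length-map; length-++-sucʳ; map-tabulate; filter-all; filter-some)
open import Data.List.Relation.Unary.All as All using (All; []; _∷_)
open import Data.List.Relation.Unary.Any using (here; there)
open import Data.List.Relation.Unary.Unique.Propositional.Properties using (filter⁺)
open import Data.List.Relation.Unary.AllPairs using (_∷_)
open import Data.List.Relation.Binary.Subset.Propositional using (_⊆_)
open import Data.List.Membership.Propositional using (lose)
open import Data.List.Membership.Propositional.Properties
  using (∈-∃++; ∈-++⁻; ∈-++⁺ˡ; ∈-++⁺ʳ; ∈-map⁺; ∈-filter⁺; ∈-filter⁻; ∈-allFin)
open import Data.List.Extrema.Nat using (argmax; argmax-sel; f[⊥]≤f[argmax]; f[xs]≤f[argmax])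
open import Data.Fin using (suc)
open import Data.Fin.Subset using (_∪_; _─_; inside; outside)
open import Data.Fin.Subset.Properties using (_∈?_; x∈p∪q⁺)
open import Data.Vec using (_∷_; [])
import Data.Vec as Vec
open import Function using (_∘_; id)
open import Relation.Nullary using (Dec; yes; no; contradiction)
open import Relation.Binary.PropositionalEquality using (refl; sym; trans; cong; cong₂; subst; module ≡-Reasoning)

private
  variable
    a r : Level
    X Y : Set a

length-mono-⊆ : {xs ys : List X} → Unique xs → xs ⊆ ys → length xs ≤ length ys
length-mono-⊆ {xs = []} _ _ = z≤n
length-mono-⊆ {xs = x ∷ xs} {ys} (x∉xs ∷ uniq) xs⊆ys
  with us , vs , refl ← ∈-∃++ (xs⊆ys (here refl)) =
  ≤-trans (s≤s (length-mono-⊆ uniq xs⊆us++vs)) (≤-reflexive (sym (length-++-sucʳ us x vs)))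
  where
  xs⊆us++vs : xs ⊆ us ++ vs
  xs⊆us++vs {z} z∈xs with ∈-++⁻ us (xs⊆ys (there z∈xs))
  ... | inj₁ z∈us = ∈-++⁺ˡ z∈us
  ... | inj₂ (here refl) = contradiction refl (All.lookup x∉xs z∈xs)
  ... | inj₂ (there z∈vs) = ∈-++⁺ʳ us z∈vs

module _ {R : X → Y → Set r} (R? : ∀ x y → Dec (R x y)) where

  double-counting : ∀ xs ys →
    sum (map (λ x → length (filter (R? x) ys)) xs) ≡
    sum (map (λ y → length (filter (λ x → R? x y) xs)) ys)
  double-counting [] ys = sym (column-[] ys)
    where
    column-[] : ∀ ys → sum (map (λ y → length (filter (λ x → R? x y) [])) ys) ≡ 0
    column-[] [] = refl
    column-[] (y ∷ ys) = column-[] ys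
  double-counting (x ∷ xs) ys = begin
    row ys + sum (map (λ x → length (filter (R? x) ys)) xs)  ≡⟨ cong (row ys +_) (double-counting xs ys) ⟩
    row ys + column xs ys                                    ≡⟨ column-∷ ys ⟨
    column (x ∷ xs) ys                                       ∎
    where
    open ≡-Reasoning
    row : List Y → ℕ
    row ys = length (filter (R? x) ys)
    cell : List X → Y → ℕ
    cell xs y = length (filter (λ x → R? x y) xs)
    column : List X → List Y → ℕ
    column xs ys = sum (map (cell xs) ys)
    add-cell : ∀ c ys {d} → d ≡ row ys + column xs ys → c + d ≡ row ys + (c + column xs ys)
    add-cell c ys refl = x∙yz≈y∙xz c (row ys) (column xs ys)
    column-∷ : ∀ ys → column (x ∷ xs) ys ≡ row ys + column xs ys
    column-∷ [] = refl
    column-∷ (y ∷ ys) with R? x y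
    ... | yes _ = cong suc (add-cell (cell xs y) ys (column-∷ ys))
    ... | no _ = add-cell (cell xs y) ys (column-∷ ys)

module _ (f : X → ℕ) where

  sum≤length*bound : ∀ {xs c} → All (λ x → f x ≤ c) xs → sum (map f xs) ≤ length xs * c
  sum≤length*bound [] = z≤n
  sum≤length*bound (fx≤c ∷ fxs≤c) = +-mono-≤ fx≤c (sum≤length*bound fxs≤c)

  ∃-≥-average : ∀ xs → 0 < length xs → ∃[ y ] y ∈ xs × sum (map f xs) ≤ length xs * f y
  ∃-≥-average (x ∷ xs) _ =
    argmax f x xs ,
    [ here , there ]′ (argmax-sel f x xs) ,
    sum≤length*bound (f[⊥]≤f[argmax] {f = f} x xs ∷ f[xs]≤f[argmax] {f = f} x xs)

  length≤sum : ∀ xs →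
    length (filter (λ x → f x ≟ 0) xs) ≤ length (filter (λ x → 2 ≤? f x) xs) →
    length xs ≤ sum (map f xs)
  length≤sum xs zeros≤bigs = +-cancelʳ-≤ _ _ _ (begin
    length xs + bigs xs          ≤⟨ weighted xs ⟩
    zeros xs + sum (map f xs)    ≤⟨ +-monoˡ-≤ _ zeros≤bigs ⟩
    bigs xs + sum (map f xs)     ≡⟨ +-comm (bigs xs) _ ⟩
    sum (map f xs) + bigs xs     ∎)
    where
    open ≤-Reasoning
    zeros bigs : List X → ℕ
    zeros xs = length (filter (λ x → f x ≟ 0) xs)
    bigs xs = length (filter (λ x → 2 ≤? f x) xs)
    -- termwise: 1 + [2 ≤ f x] ≤ [f x ≡ 0] + f x
    weighted : ∀ xs → length xs + bigs xs ≤ zeros xs + sum (map f xs)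
    weighted [] = z≤n
    weighted (x ∷ xs) with f x
    ... | zero = s≤s (weighted xs)
    ... | suc zero = begin
      suc (length xs + bigs xs)    ≤⟨ s≤s (weighted xs) ⟩
      suc (zeros xs + S)           ≡⟨ +-suc (zeros xs) S ⟨
      zeros xs + suc S             ∎
      where
      S : ℕ
      S = sum (map f xs)
    ... | suc (suc m) = begin
      suc (length xs + suc (bigs xs))  ≡⟨ cong suc (+-suc (length xs) (bigs xs)) ⟩
      suc (suc (length xs + bigs xs))  ≤⟨ s≤s (s≤s (≤-trans (weighted xs) (+-monoʳ-≤ (zeros xs) (m≤n+m S m)))) ⟩
      suc (suc (zeros xs + (m + S)))   ≡⟨ cong suc (+-suc (zeros xs) (m + S)) ⟨
      suc (zeros xs + suc (m + S))     ≡⟨ +-suc (zeros xs) (suc (m + S)) ⟨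
      zeros xs + suc (suc (m + S))     ∎
      where
      S : ℕ
      S = sum (map f xs)

n≤2^[n∸2]+1 : ∀ {n} → 2 ≤ n → n ≤ 2 ^ (n ∸ 2) + 1
n≤2^[n∸2]+1 {suc (suc m)} (s≤s (s≤s _)) = ≤-trans (s≤s (n<2^n m)) (≤-reflexive (+-comm 1 (2 ^ m)))
  where
  n<2^n : ∀ n → n < 2 ^ n
  n<2^n zero = s≤s z≤n
  n<2^n (suc n) = ≤-trans (s≤s (n<2^n n)) (^-monoʳ-< 2 (s≤s (s≤s z≤n)) (n<1+n n))

elements : ∀ {n} → Subset n → List (Fin n)
elements {n} p = filter (_∈? p) (allFin n)

module _ {n} {p : Subset n} {y : Fin n} where

  ∈-elements⁺ : y S.∈ p → y ∈ elements p
  ∈-elements⁺ = ∈-filter⁺ (_∈? p) (∈-allFin y)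

  ∈-elements⁻ : y ∈ elements p → y S.∈ p
  ∈-elements⁻ y∈ = proj₂ (∈-filter⁻ (_∈? p) {xs = allFin n} y∈)

length-elements-tail : ∀ {n x} (p : Subset n) →
  length (filter (_∈? (x ∷ p)) (tabulate suc)) ≡ length (elements p)
length-elements-tail {n} {x} p = begin
  length (filter (_∈? (x ∷ p)) (tabulate suc))
    ≡⟨ cong (length ∘ filter (_∈? (x ∷ p))) (map-tabulate id suc) ⟨
  length (filter (_∈? (x ∷ p)) (map suc (allFin n)))
    ≡⟨ cong length (filter-map-suc (allFin n)) ⟩
  length (map suc (elements p))
    ≡⟨ length-map suc (elements p) ⟩
  length (elements p) ∎
  where
  open ≡-Reasoning
  filter-map-suc : ∀ ys → filter (_∈? (x ∷ p)) (map suc ys) ≡ map suc (filter (_∈? p) ys)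
  filter-map-suc [] = refl
  filter-map-suc (y ∷ ys) with y ∈? p
  ... | yes _ = cong (suc y ∷_) (filter-map-suc ys)
  ... | no _ = filter-map-suc ys

length-elements : ∀ {n} (p : Subset n) → length (elements p) ≡ ∣ p ∣
length-elements [] = refl
length-elements (inside ∷ p) = cong suc (trans (length-elements-tail p) (length-elements p))
length-elements (outside ∷ p) = trans (length-elements-tail p) (length-elements p)

p∪q─q≡p : ∀ {n} {p q : Subset n} → (∀ {x} → x S.∈ q → x S.∉ p) → p ∪ q ─ q ≡ p
p∪q─q≡p {p = []} {[]} _ = refl
p∪q─q≡p {p = x ∷ p} {outside ∷ q} q∩p≡∅ =
  cong₂ _∷_ (∨-identityʳ x) (p∪q─q≡p λ x∈q → q∩p≡∅ (Vec.there x∈q) ∘ Vec.there)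
p∪q─q≡p {p = outside ∷ p} {inside ∷ q} q∩p≡∅ =
  cong (outside ∷_) (p∪q─q≡p λ x∈q → q∩p≡∅ (Vec.there x∈q) ∘ Vec.there)
p∪q─q≡p {p = inside ∷ p} {inside ∷ q} q∩p≡∅ = contradiction Vec.here (q∩p≡∅ Vec.here)

module _ {n} (A : Subset n) where

  hits : Subset n → ℕ
  hits F = length (filter (_∈? F) (elements A))

  hits-∪ : ∀ F → hits (F ∪ A) ≡ ∣ A ∣
  hits-∪ F = trans (cong length (filter-all (_∈? F ∪ A) A⊆F∪A)) (length-elements A)
    where
    A⊆F∪A : All (S._∈ F ∪ A) (elements A)
    A⊆F∪A = All.tabulate λ y∈A → x∈p∪q⁺ (inj₂ (∈-elements⁻ y∈A))

  hits≡0⇒disjoint : ∀ {F} → hits F ≡ 0 → ∀ {y} → y S.∈ A → y S.∉ F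
  hits≡0⇒disjoint {F} hits≡0 y∈A y∈F =
    n>0⇒n≢0 (filter-some (_∈? F) (lose (∈-elements⁺ y∈A) y∈F)) hits≡0

  module _ {𝓕 : List (Subset n)} (uniq : Unique 𝓕) (closed : UnionClosed 𝓕) (A∈𝓕 : A ∈ 𝓕)
           (2≤∣A∣ : 2 ≤ ∣ A ∣) where

    #hits≡0≤#hits≥2 :
      length (filter (λ F → hits F ≟ 0) 𝓕) ≤ length (filter (λ F → 2 ≤? hits F) 𝓕)
    #hits≡0≤#hits≥2 = begin
      length (filter disjoint? 𝓕)           ≤⟨ length-mono-⊆ (filter⁺ disjoint? uniq) disjoint⊆ ⟩
      length (map (_─ A) (filter big? 𝓕))   ≡⟨ length-map (_─ A) (filter big? 𝓕) ⟩
      length (filter big? 𝓕)                ∎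
      where
      open ≤-Reasoning
      disjoint? : ∀ F → Dec (hits F ≡ 0)
      disjoint? F = hits F ≟ 0
      big? : ∀ F → Dec (2 ≤ hits F)
      big? F = 2 ≤? hits F
      disjoint⊆ : filter disjoint? 𝓕 ⊆ map (_─ A) (filter big? 𝓕)
      disjoint⊆ {F} F∈ with F∈𝓕 , hits≡0 ← ∈-filter⁻ disjoint? F∈ =
        subst (_∈ map (_─ A) (filter big? 𝓕)) (p∪q─q≡p (hits≡0⇒disjoint hits≡0))
          (∈-map⁺ (_─ A) (∈-filter⁺ big? (closed F∈𝓕 A∈𝓕) (subst (2 ≤_) (sym (hits-∪ F)) 2≤∣A∣)))

    length≤sum-hits : length 𝓕 ≤ sum (map hits 𝓕)
    length≤sum-hits = length≤sum hits 𝓕 #hits≡0≤#hits≥2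

proposition3p4 : (n : ℕ) → 1 ≤ n → (𝓕 : List (Subset n)) → Unique 𝓕 →
    UnionClosed 𝓕 → ⋃ 𝓕 ≡ ⊤ →
    (A : Subset n) → A ∈ 𝓕 → 2 ≤ ∣ A ∣ →
    Σ (Fin n) (λ y → y S.∈ A × length 𝓕 ≤ count y 𝓕 * (2 ^ (∣ A ∣ ∸ 2) + 1))
proposition3p4 n _ 𝓕 uniq closed _ A A∈𝓕 2≤∣A∣
  with y , y∈A , sum≤length*count ← ∃-≥-average (λ y → count y 𝓕) (elements A)
    (subst (0 <_) (sym (length-elements A)) (≤-trans (s≤s z≤n) 2≤∣A∣)) =
  y , ∈-elements⁻ y∈A , (begin
    length 𝓕                                    ≤⟨ length≤sum-hits A uniq closed A∈𝓕 2≤∣A∣ ⟩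
    sum (map (hits A) 𝓕)                        ≡⟨ double-counting _∈?_ (elements A) 𝓕 ⟨
    sum (map (λ y → count y 𝓕) (elements A))    ≤⟨ sum≤length*count ⟩
    length (elements A) * count y 𝓕             ≡⟨ cong (_* count y 𝓕) (length-elements A) ⟩
    ∣ A ∣ * count y 𝓕                           ≤⟨ *-monoˡ-≤ (count y 𝓕) (n≤2^[n∸2]+1 2≤∣A∣) ⟩
    (2 ^ (∣ A ∣ ∸ 2) + 1) * count y 𝓕           ≡⟨ *-comm _ (count y 𝓕) ⟩
    count y 𝓕 * (2 ^ (∣ A ∣ ∸ 2) + 1)           ∎)
  where
  open ≤-Reasoning
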